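{- Let $p$ be a prime and let $L=\{l_1,\ldots,l_s\}$ and $K=\{k_1,\ldots,k_r\}$ be disjoint subsets of $\{0,1,\ldots,p-1\}$. Let $\mathcal{A}=\{A_1,\ldots,A_m\}$ be a family of subsets of $[n]$ such that $|A_i|\pmod p\in K$ for every $i$ and $|A_i\cap A_j|\pmod p\in L$ for all $i\neq j$. Let $X=[n-1]$, and for each $I\subseteq X$ define the linear form $L_I=\sum_{i:\, I\subseteq A_i} x_i$ in the variables $x_1,\ldots,x_m$ over $\mathbb{F}_p$. Then for any $i\in\{0,1,\ldots,s-2r+1\}$ and every $I\subseteq X$ with $|I|=i$, the linear form \[ \sum_{H\subseteq X,\ |H|=i+2r,\ I\subseteq H}L_{H} \] lies in the $\mathbb{F}_p$-linear span of $\{L_{H}: H\subseteq X,\ i\leq |H|\leq i+2r-1\}$. -}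

module Defs where

open import Data.Nat as ℕ using (ℕ; zero; suc; _<ᵇ_)
open import Data.Integer using (ℤ; +_; _-_; _+_; _*_)
open import Data.Integer.Divisibility using (_∣_)
open import Data.Fin using (Fin; toℕ)
open import Data.Fin.Subset using (Subset; inside; outside; _⊆_; ∣_∣)
open import Data.Fin.Subset.Properties using (_⊆?_)
open import Data.Vec using ([]; _∷_; tabulate)
open import Data.List using (List; []; _∷_; map; _++_; foldr; filter)
open import Data.Product using (Σ; _×_; _,_; proj₁; proj₂)
open import Data.Bool using (if_then_else_)
open import Data.List.Relation.Unary.All using (All)
open import Relation.Nullary using (does)
open import Relation.Unary using (Pred; Decidable)
import Level

_≡_[mod_] : ℤ → ℤ → ℕ → Set
a ≡ b [mod p ] = (+ p) ∣ (a - b)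

allSubsets : (n : ℕ) → List (Subset n)
allSubsets zero    = [] ∷ []
allSubsets (suc n) = map (outside ∷_) (allSubsets n) ++ map (inside ∷_) (allSubsets n)

-- [n] = {1,…,n} is modelled by Fin n (element x ↦ toℕ x + 1).
-- X = [n-1] = {1,…,n-1} as a subset of [n]: those x with toℕ x + 1 < n.
X : (n : ℕ) → Subset n
X n = tabulate (λ x → if suc (toℕ x) <ᵇ n then inside else outside)

-- A linear form in the variables x_1..x_m, given by its coefficient vector
-- (integers, read modulo p, i.e. over F_p).
LinForm : ℕ → Set
LinForm m = Fin m → ℤ

Lform : {m n : ℕ} → (Fin m → Subset n) → Subset n → LinForm m
Lform A I k = if does (I ⊆? A k) then + 1 else + 0

zeroForm : {m : ℕ} → LinForm m
zeroForm k = + 0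

_⊕_ : {m : ℕ} → LinForm m → LinForm m → LinForm m
(f ⊕ g) k = f k + g k

sumForms : {m n : ℕ} → (Fin m → Subset n) → List (Subset n) → LinForm m
sumForms A Hs = foldr (λ H acc → Lform A H ⊕ acc) zeroForm Hs

linComb : {m n : ℕ} → (Fin m → Subset n) → List (Subset n × ℤ) → LinForm m
linComb A cs = foldr (λ Hc acc → (λ k → proj₂ Hc * Lform A (proj₁ Hc) k) ⊕ acc) zeroForm cs

InSpan : {m n : ℕ} → ℕ → (Fin m → Subset n) → (Subset n → Set) → LinForm m → Set
InSpan {m} {n} p A S v =
  Σ (List (Subset n × ℤ)) λ cs →
    All (λ Hc → S (proj₁ Hc)) cs × ((k : Fin m) → v k ≡ linComb A cs k [mod p ])

sumFormsWhere : {m n : ℕ} → (Fin m → Subset n) → {P : Pred (Subset n) Level.zero} → Decidable P → LinForm m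
sumFormsWhere {n = n} A P? = sumForms A (filter P? (allSubsets n))

module Submission where

-- Coordinate k of Σ { L_H : I ⊆ H ⊆ X, |H| = |I| + t } counts such H inside A_k, i.e.
-- it is C(f_k, t) with f_k = |(X ∩ A_k) ─ I| when I ⊆ A_k, and 0 otherwise (Counting,
-- LinearForms).  So a relation C(f_k, N) ≡ Σ_{t<N} c_t C(f_k, t) (mod p), with c
-- independent of k, is exactly the desired linear relation (LayerReduction).
--  * If 2|K| < p: |A_k| = |I| + f_k + e_k with e_k = [n ∈ A_k] ∈ {0, 1}, and |A_k| ≡ κ
--    for some κ ∈ K, so f_k is a root modulo p of Π_{κ ∈ K} (x - κ + |I|)(x - κ + |I| + 1),
--    of degree N = 2|K|.  Expanding this product in the binomial basis as
--    N!·C(x, N) + Σ_{t<N} d_t C(x, t) (BinomialBasis) and inverting N! modulo p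
--    (RootsModulo) gives the relation.
--  * If 2|K| ≥ p, the size hypotheses force p = 2, |K| = 1 and I = ∅.  Then the
--    intersection condition makes explicit combinations G_j of the L_H with |H| ≤ 1
--    satisfy G_j(l) ≡ δ_{jl} (mod 2), and Σ_j C(|X ∩ A_j|, 2) G_j works (ParityTwo).

open import Data.Nat.Base using (ℕ)
open import Defs

-- Congruence of integers modulo p, phrased with signed divisibility (whose quotient
-- can be manipulated); it agrees with _≡_[mod_] of Defs.
module Congruence (p : ℕ) where

  open import Data.Nat as ℕ using (suc; zero)
  open import Data.Integer as ℤ using (ℤ; +_; _+_; _*_; _-_; -_; 0ℤ; 1ℤ)
  import Data.Integer.Properties as ℤ
  import Data.Integer.Tactic.RingSolver as ℤ-Ring
  open import Data.Integer.Divisibility.Signed as Signed using (divides; ∣ᵤ⇒∣; ∣⇒∣ᵤ)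
  open import Data.Nat.Coprimality using (Coprime; coprime-Bézout)
  open import Data.Nat.GCD using (module Bézout)
  open import Algebra.Definitions.RawMonoid ℤ.+-0-rawMonoid using (sum)
  open import Data.Fin as Fin using (Fin)
  import Data.Fin.Properties as Fin
  open import Data.Product using (∃-syntax; _,_)
  open import Function using (_∘_)
  open import Relation.Binary.Bundles using (Setoid)
  open import Relation.Binary.Structures using (IsEquivalence)
  import Relation.Binary.Reasoning.Setoid
  open import Relation.Binary.PropositionalEquality
    using (_≡_; _≢_; refl; sym; cong; module ≡-Reasoning)

  infix 4 _≈_
  record _≈_ (a b : ℤ) : Set where
    constructor ≈-intro
    field p∣a-b : + p Signed.∣ (a - b)

  ≈⇒≡[mod] : ∀ {a b} → a ≈ b → a ≡ b [mod p ]
  ≈⇒≡[mod] (≈-intro p∣a-b) = ∣⇒∣ᵤ p∣a-b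

  ≡[mod]⇒≈ : ∀ {a b} → a ≡ b [mod p ] → a ≈ b
  ≡[mod]⇒≈ p∣a-b = ≈-intro (∣ᵤ⇒∣ p∣a-b)

  ≈-reflexive : ∀ {a b} → a ≡ b → a ≈ b
  ≈-reflexive a≡b = ≈-intro (divides 0ℤ (ℤ.i≡j⇒i-j≡0 a≡b))

  ≈-refl : ∀ {a} → a ≈ a
  ≈-refl = ≈-reflexive refl

  ≈-sym : ∀ {a b} → a ≈ b → b ≈ a
  ≈-sym {a} {b} (≈-intro p∣a-b) =
    ≈-intro (Signed.∣-trans (Signed.∣m⇒∣-m p∣a-b) (Signed.∣-reflexive (negate a b)))
    where
    negate : ∀ a b → - (a - b) ≡ b - a
    negate = ℤ-Ring.solve-∀

  ≈-trans : ∀ {a b c} → a ≈ b → b ≈ c → a ≈ c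
  ≈-trans {a} {b} {c} (≈-intro p∣a-b) (≈-intro p∣b-c) = ≈-intro
    (Signed.∣-trans (Signed.∣m∣n⇒∣m+n p∣a-b p∣b-c) (Signed.∣-reflexive (ℤ.+-minus-telescope a b c)))

  ≈-isEquivalence : IsEquivalence _≈_
  ≈-isEquivalence = record { refl = ≈-refl ; sym = ≈-sym ; trans = ≈-trans }

  ≈-setoid : Setoid _ _
  ≈-setoid = record { isEquivalence = ≈-isEquivalence }

  module ≈-Reasoning = Relation.Binary.Reasoning.Setoid ≈-setoid

  +-cong : ∀ {a b c d} → a ≈ b → c ≈ d → a + c ≈ b + d
  +-cong {a} {b} {c} {d} (≈-intro p∣a-b) (≈-intro p∣c-d) =
    ≈-intro (Signed.∣-trans (Signed.∣m∣n⇒∣m+n p∣a-b p∣c-d) (Signed.∣-reflexive (regroup a b c d)))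
    where
    regroup : ∀ a b c d → (a - b) + (c - d) ≡ (a + c) - (b + d)
    regroup = ℤ-Ring.solve-∀

  *-congˡ : ∀ c {a b} → a ≈ b → c * a ≈ c * b
  *-congˡ c {a} {b} (≈-intro p∣a-b) =
    ≈-intro (Signed.∣-trans (Signed.∣n⇒∣m*n c p∣a-b) (Signed.∣-reflexive (distribute c a b)))
    where
    distribute : ∀ c a b → c * (a - b) ≡ c * a - c * b
    distribute = ℤ-Ring.solve-∀

  *-congʳ : ∀ c {a b} → a ≈ b → a * c ≈ b * c
  *-congʳ c {a} {b} a≈b = ≈-trans (≈-reflexive (ℤ.*-comm a c)) (≈-trans (*-congˡ c a≈b) (≈-reflexive (ℤ.*-comm c b)))

  difference≈0 : ∀ {a b} → a ≈ b → a - b ≈ 0ℤ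
  difference≈0 {a} {b} (≈-intro p∣a-b) = ≈-intro (Signed.∣-trans p∣a-b (Signed.∣-reflexive (sym (ℤ.+-identityʳ (a - b)))))

  multiple≈0 : ∀ q → q * + p ≈ 0ℤ
  multiple≈0 q = ≈-intro (divides q (ℤ.+-identityʳ (q * + p)))

  sum-concentrated : ∀ {m} (f : Fin m → ℤ) l {v} → (∀ j → j ≢ l → f j ≈ 0ℤ) → f l ≈ v → sum f ≈ v
  sum-concentrated {suc m} f Fin.zero {v} f≈0 fl≈v = begin
    f Fin.zero + sum (f ∘ Fin.suc)  ≈⟨ +-cong fl≈v (sum≈0 (f ∘ Fin.suc) (λ j → f≈0 (Fin.suc j) λ ())) ⟩
    v + 0ℤ                         ≡⟨ ℤ.+-identityʳ v ⟩
    v                              ∎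
    where
    open ≈-Reasoning
    sum≈0 : ∀ {r} (g : Fin r → ℤ) → (∀ j → g j ≈ 0ℤ) → sum g ≈ 0ℤ
    sum≈0 {zero}  g g≈0 = ≈-refl
    sum≈0 {suc r} g g≈0 = +-cong (g≈0 Fin.zero) (sum≈0 (g ∘ Fin.suc) (g≈0 ∘ Fin.suc))
  sum-concentrated {suc m} f (Fin.suc l) {v} f≈0 fl≈v = begin
    f Fin.zero + sum (f ∘ Fin.suc)  ≈⟨ +-cong (f≈0 Fin.zero λ ()) (sum-concentrated (f ∘ Fin.suc) l (λ j j≢l → f≈0 (Fin.suc j) (j≢l ∘ Fin.suc-injective)) fl≈v) ⟩
    0ℤ + v                         ≡⟨ ℤ.+-identityˡ v ⟩
    v                              ∎
    where open ≈-Reasoning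

  coprime⇒invertible : ∀ {a} → Coprime p a → ∃[ w ] (w * + a ≈ 1ℤ)
  coprime⇒invertible {a} coprime with coprime-Bézout coprime
  ... | Bézout.+- x y 1+ya≡xp = - + y , ≈-intro (divides (- + x) (begin
    - + y * + a - 1ℤ     ≡⟨ rearrange (+ y) (+ a) ⟩
    - (1ℤ + + y * + a)   ≡⟨ cong (λ z → - (1ℤ + z)) (ℤ.pos-* y a) ⟨
    - + (1 ℕ.+ y ℕ.* a)  ≡⟨ cong (λ z → - + z) 1+ya≡xp ⟩
    - + (x ℕ.* p)        ≡⟨ cong -_ (ℤ.pos-* x p) ⟩
    - (+ x * + p)        ≡⟨ ℤ.neg-distribˡ-* (+ x) (+ p) ⟩
    - + x * + p          ∎))
    where
    open ≡-Reasoning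
    rearrange : ∀ y a → - y * a - 1ℤ ≡ - (1ℤ + y * a)
    rearrange = ℤ-Ring.solve-∀
  ... | Bézout.-+ x y 1+xp≡ya = + y , ≈-intro (divides (+ x) (begin
    + y * + a - 1ℤ              ≡⟨ cong (_- 1ℤ) (ℤ.pos-* y a) ⟨
    + (y ℕ.* a) - 1ℤ            ≡⟨ cong (λ z → + z - 1ℤ) 1+xp≡ya ⟨
    + (1 ℕ.+ x ℕ.* p) - 1ℤ      ≡⟨ cong (λ z → 1ℤ + z - 1ℤ) (ℤ.pos-* x p) ⟩
    1ℤ + + x * + p - 1ℤ         ≡⟨ cancel (+ x * + p) ⟩
    + x * + p                   ∎))
    where
    open ≡-Reasoning
    cancel : ∀ z → 1ℤ + z - 1ℤ ≡ z
    cancel = ℤ-Ring.solve-∀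

module BinomialBasis where

  open import Data.Nat as ℕ using (zero; suc; _!)
  import Data.Nat.Properties as ℕ
  import Data.Nat.Tactic.RingSolver as ℕ-Ring
  open import Data.Nat.Combinatorics using (_C_; nCk+nC[k+1]≡[n+1]C[k+1]; nC1≡n)
  open import Data.Integer as ℤ using (ℤ; +_; _+_; _*_; _-_; 0ℤ; 1ℤ)
  import Data.Integer.Properties as ℤ
  import Data.Integer.Tactic.RingSolver as ℤ-Ring
  open import Data.List using (List; []; _∷_; length)
  open import Data.Product using (∃-syntax; _,_)
  open import Relation.Nullary using (yes; no; contradiction)
  open import Relation.Binary.PropositionalEquality
    using (_≡_; refl; sym; cong; cong₂; module ≡-Reasoning)

  -- Absorption identity for binomial coefficients:  x·C(x,j) = (j+1)·C(x,j+1) + j·C(x,j).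
  -- It describes multiplication by x in the binomial basis {C(x,t)}.
  binomial-absorption : ∀ x j → x ℕ.* (x C j) ≡ suc j ℕ.* (x C suc j) ℕ.+ j ℕ.* (x C j)
  binomial-absorption zero    zero    = refl
  binomial-absorption zero    (suc j) = sym (cong₂ ℕ._+_ (ℕ.*-zeroʳ (suc (suc j))) (ℕ.*-zeroʳ (suc j)))
  binomial-absorption (suc x) zero    = begin
    suc x ℕ.* 1              ≡⟨ ℕ.*-identityʳ (suc x) ⟩
    suc x                    ≡⟨ nC1≡n (suc x) ⟨
    suc x C 1                ≡⟨ unit (suc x C 1) ⟩
    1 ℕ.* (suc x C 1) ℕ.+ 0  ∎
    where
    open ≡-Reasoning
    unit : ∀ c → c ≡ 1 ℕ.* c ℕ.+ 0
    unit = ℕ-Ring.solve-∀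
  binomial-absorption (suc x) (suc j) = begin
    suc x ℕ.* (suc x C suc j)
      ≡⟨ cong (suc x ℕ.*_) (pascal j) ⟨
    suc x ℕ.* (c₀ ℕ.+ c₁)
      ≡⟨ expand x c₀ c₁ ⟩
    c₀ ℕ.+ c₁ ℕ.+ x ℕ.* c₀ ℕ.+ x ℕ.* c₁
      ≡⟨ cong₂ (λ u v → c₀ ℕ.+ c₁ ℕ.+ u ℕ.+ v) (binomial-absorption x j) (binomial-absorption x (suc j)) ⟩
    c₀ ℕ.+ c₁ ℕ.+ (suc j ℕ.* c₁ ℕ.+ j ℕ.* c₀) ℕ.+ (suc (suc j) ℕ.* c₂ ℕ.+ suc j ℕ.* c₁)
      ≡⟨ collect j c₀ c₁ c₂ ⟩
    suc (suc j) ℕ.* (c₁ ℕ.+ c₂) ℕ.+ suc j ℕ.* (c₀ ℕ.+ c₁)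
      ≡⟨ cong₂ (λ u v → suc (suc j) ℕ.* u ℕ.+ suc j ℕ.* v) (pascal (suc j)) (pascal j) ⟩
    suc (suc j) ℕ.* (suc x C suc (suc j)) ℕ.+ suc j ℕ.* (suc x C suc j) ∎
    where
    open ≡-Reasoning
    c₀ = x C j
    c₁ = x C suc j
    c₂ = x C suc (suc j)
    pascal : ∀ k → x C k ℕ.+ x C suc k ≡ suc x C suc k
    pascal = nCk+nC[k+1]≡[n+1]C[k+1] x
    expand : ∀ x a b → suc x ℕ.* (a ℕ.+ b) ≡ a ℕ.+ b ℕ.+ x ℕ.* a ℕ.+ x ℕ.* b
    expand = ℕ-Ring.solve-∀
    collect : ∀ j a b c → a ℕ.+ b ℕ.+ (suc j ℕ.* b ℕ.+ j ℕ.* a) ℕ.+ (suc (suc j) ℕ.* c ℕ.+ suc j ℕ.* b)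
                        ≡ suc (suc j) ℕ.* (b ℕ.+ c) ℕ.+ suc j ℕ.* (a ℕ.+ b)
    collect = ℕ-Ring.solve-∀

  binomialSum : ℕ → (ℕ → ℤ) → ℕ → ℤ
  binomialSum zero    d x = 0ℤ
  binomialSum (suc N) d x = binomialSum N d x + d N * + (x C N)

  binomialSum-cong : ∀ N {d e} → (∀ t → t ℕ.< N → d t ≡ e t) → ∀ x → binomialSum N d x ≡ binomialSum N e x
  binomialSum-cong zero    d≗e x = refl
  binomialSum-cong (suc N) d≗e x = cong₂ _+_
    (binomialSum-cong N (λ t t<N → d≗e t (ℕ.m<n⇒m<1+n t<N)) x)
    (cong (_* + (x C N)) (d≗e N (ℕ.n<1+n N)))

  binomialSum-scale : ∀ N c d x → binomialSum N (λ t → c * d t) x ≡ c * binomialSum N d x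
  binomialSum-scale zero    c d x = sym (ℤ.*-zeroʳ c)
  binomialSum-scale (suc N) c d x = begin
    binomialSum N (λ t → c * d t) x + c * d N * + (x C N)  ≡⟨ cong (_+ c * d N * + (x C N)) (binomialSum-scale N c d x) ⟩
    c * binomialSum N d x + c * d N * + (x C N)            ≡⟨ factor c (binomialSum N d x) (d N) (+ (x C N)) ⟩
    c * (binomialSum N d x + d N * + (x C N))              ∎
    where
    open ≡-Reasoning
    factor : ∀ c s a b → c * s + c * a * b ≡ c * (s + a * b)
    factor = ℤ-Ring.solve-∀

  previous : (ℕ → ℤ) → ℕ → ℤ
  previous d zero    = 0ℤ
  previous d (suc t) = d t

  -- Coordinates of (x - s) · Σ d t · C(x,t) below the top degree, by absorption.
  multiplyByRoot : ℤ → (ℕ → ℤ) → ℕ → ℤ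
  multiplyByRoot s d t = (+ t - s) * d t + + t * previous d t

  absorption : ∀ x t → + x * + (x C t) ≡ + suc t * + (x C suc t) + + t * + (x C t)
  absorption x t = begin
    + x * + (x C t)                                 ≡⟨ ℤ.pos-* x (x C t) ⟨
    + (x ℕ.* (x C t))                               ≡⟨ cong +_ (binomial-absorption x t) ⟩
    + (suc t ℕ.* (x C suc t) ℕ.+ t ℕ.* (x C t))     ≡⟨ cong₂ _+_ (ℤ.pos-* (suc t) _) (ℤ.pos-* t _) ⟩
    + suc t * + (x C suc t) + + t * + (x C t)       ∎
    where open ≡-Reasoning

  binomialSum-multiply : ∀ s d x N →
    (+ x - s) * binomialSum N d x ≡ binomialSum N (multiplyByRoot s d) x + (+ N * previous d N) * + (x C N)
  binomialSum-multiply s d x zero    = ℤ.*-zeroʳ (+ x - s)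
  binomialSum-multiply s d x (suc N) = begin
    (+ x - s) * (binomialSum N d x + d N * b)
      ≡⟨ distribute (+ x) s (binomialSum N d x) (d N) b ⟩
    (+ x - s) * binomialSum N d x + d N * (+ x * b - s * b)
      ≡⟨ cong₂ (λ u v → u + d N * (v - s * b)) (binomialSum-multiply s d x N) (absorption x N) ⟩
    binomialSum N (multiplyByRoot s d) x + (+ N * previous d N) * b + d N * (+ suc N * b′ + + N * b - s * b)
      ≡⟨ collect (binomialSum N (multiplyByRoot s d) x) (+ N) (previous d N) (d N) b b′ (+ suc N) s ⟩
    binomialSum N (multiplyByRoot s d) x + multiplyByRoot s d N * b + (+ suc N * d N) * b′ ∎
    where
    open ≡-Reasoning
    b  = + (x C N)
    b′ = + (x C suc N)
    distribute : ∀ x s S a b → (x - s) * (S + a * b) ≡ (x - s) * S + a * (x * b - s * b)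
    distribute = ℤ-Ring.solve-∀
    collect : ∀ S n a c b b′ n₁ s → S + (n * a) * b + c * (n₁ * b′ + n * b - s * b)
                                  ≡ S + ((n - s) * c + n * a) * b + (n₁ * c) * b′
    collect = ℤ-Ring.solve-∀

  withTop : ℕ → (ℕ → ℤ) → ℤ → ℕ → ℤ
  withTop N d c t with t ℕ.<? N
  ... | yes _ = d t
  ... | no  _ = c

  withTop-below : ∀ N d c t → t ℕ.< N → withTop N d c t ≡ d t
  withTop-below N d c t t<N with t ℕ.<? N
  ... | yes _   = refl
  ... | no  t≮N = contradiction t<N t≮N

  withTop-top : ∀ N d c → withTop N d c N ≡ c
  withTop-top N d c with N ℕ.<? N
  ... | yes N<N = contradiction N<N (ℕ.n≮n N)
  ... | no  _   = refl

  rootProduct : List ℤ → ℕ → ℤ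
  rootProduct []       x = 1ℤ
  rootProduct (s ∷ ss) x = (+ x - s) * rootProduct ss x

  rootProduct-expansion : ∀ ss → ∃[ d ] ∀ x →
    rootProduct ss x ≡ + (length ss !) * + (x C length ss) + binomialSum (length ss) d x
  rootProduct-expansion []       = (λ _ → 0ℤ) , λ x → refl
  rootProduct-expansion (s ∷ ss) with rootProduct-expansion ss
  ... | d , expansion = e , step
    where
    N = length ss
    F = + (N !)
    top = + N * previous d N + F * (+ N - s)
    e = withTop N (multiplyByRoot s d) top

    lowerPart : ∀ x → binomialSum (suc N) e x ≡ binomialSum N (multiplyByRoot s d) x + top * + (x C N)
    lowerPart x = cong₂ (λ u v → u + v * + (x C N))
      (binomialSum-cong N (withTop-below N (multiplyByRoot s d) top) x) (withTop-top N (multiplyByRoot s d) top)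

    step : ∀ x → (+ x - s) * rootProduct ss x ≡ + (suc N !) * + (x C suc N) + binomialSum (suc N) e x
    step x = begin
      (+ x - s) * rootProduct ss x
        ≡⟨ cong ((+ x - s) *_) (expansion x) ⟩
      (+ x - s) * (F * b + binomialSum N d x)
        ≡⟨ distribute (+ x) s F b (binomialSum N d x) ⟩
      F * (+ x * b - s * b) + (+ x - s) * binomialSum N d x
        ≡⟨ cong₂ (λ u v → F * (u - s * b) + v) (absorption x N) (binomialSum-multiply s d x N) ⟩
      F * (+ suc N * b′ + + N * b - s * b) + (binomialSum N (multiplyByRoot s d) x + (+ N * previous d N) * b)
        ≡⟨ collect F (+ suc N) (+ N) s b b′ (binomialSum N (multiplyByRoot s d) x) (previous d N) ⟩
      (+ suc N * F) * b′ + (binomialSum N (multiplyByRoot s d) x + top * b)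
        ≡⟨ cong₂ (λ u v → u * b′ + v) (ℤ.pos-* (suc N) (N !)) (lowerPart x) ⟨
      + (suc N !) * b′ + binomialSum (suc N) e x ∎
      where
      open ≡-Reasoning
      b  = + (x C N)
      b′ = + (x C suc N)
      distribute : ∀ x s F b S → (x - s) * (F * b + S) ≡ F * (x * b - s * b) + (x - s) * S
      distribute = ℤ-Ring.solve-∀
      collect : ∀ F n₁ n s b b′ S a → F * (n₁ * b′ + n * b - s * b) + (S + (n * a) * b)
                                    ≡ (n₁ * F) * b′ + (S + (n * a + F * (n - s)) * b)
      collect = ℤ-Ring.solve-∀

module RootsModulo (p : ℕ) where

  open import Data.Nat as ℕ using (zero; suc; _!)
  import Data.Nat.Properties as ℕ
  open import Data.Nat.Base using (nonTrivial⇒≢1)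
  open import Data.Nat.Combinatorics using (_C_)
  open import Data.Nat.Divisibility using (_∣_; ∣1⇒≡1; ∣⇒≤)
  open import Data.Nat.Primality using (Prime; euclidsLemma; prime⇒irreducible; prime⇒nonTrivial)
  open import Data.Nat.Coprimality using (Coprime)
  open import Data.Integer as ℤ using (+_; _+_; _*_; _-_; -_; 0ℤ; 1ℤ)
  import Data.Integer.Properties as ℤ
  import Data.Integer.Tactic.RingSolver as ℤ-Ring
  open import Data.List using (_∷_; length)
  import Data.List.Membership.Propositional as List
  open import Data.List.Relation.Unary.Any using (here; there)
  open import Data.Product using (∃-syntax; _,_)
  open import Data.Sum using (inj₁; inj₂)
  open import Relation.Nullary using (¬_; contradiction)
  open import Relation.Binary.PropositionalEquality using (_≡_; refl; cong)
  open Congruence p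
  open BinomialBasis

  rootProduct-root : ∀ {ss s} x → s List.∈ ss → + x ≈ s → rootProduct ss x ≈ 0ℤ
  rootProduct-root {s ∷ ss} x (here refl) x≈s = begin
    (+ x - s) * rootProduct ss x  ≈⟨ *-congʳ (rootProduct ss x) (+-cong x≈s ≈-refl) ⟩
    (s - s) * rootProduct ss x    ≡⟨ cong (_* rootProduct ss x) (ℤ.+-inverseʳ s) ⟩
    0ℤ * rootProduct ss x         ≡⟨ ℤ.*-zeroˡ (rootProduct ss x) ⟩
    0ℤ                            ∎
    where open ≈-Reasoning
  rootProduct-root {s′ ∷ ss} x (there s∈ss) x≈s = begin
    (+ x - s′) * rootProduct ss x  ≈⟨ *-congˡ (+ x - s′) (rootProduct-root x s∈ss x≈s) ⟩
    (+ x - s′) * 0ℤ                ≡⟨ ℤ.*-zeroʳ (+ x - s′) ⟩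
    0ℤ                             ∎
    where open ≈-Reasoning

  prime∤factorial : Prime p → ∀ N → N ℕ.< p → ¬ p ∣ N !
  prime∤factorial p-prime zero    _   p∣1 = nonTrivial⇒≢1 {{prime⇒nonTrivial p-prime}} (∣1⇒≡1 p∣1)
  prime∤factorial p-prime (suc N) N<p p∣N! with euclidsLemma (suc N) (N !) p-prime p∣N!
  ... | inj₁ p∣1+N = ℕ.<⇒≱ N<p (∣⇒≤ p∣1+N)
  ... | inj₂ p∣N!  = prime∤factorial p-prime N (ℕ.<-trans (ℕ.n<1+n N) N<p) p∣N!

  prime∤⇒coprime : ∀ {a} → Prime p → ¬ p ∣ a → Coprime p a
  prime∤⇒coprime p-prime p∤a (d∣p , d∣a) with prime⇒irreducible p-prime d∣p
  ... | inj₁ d≡1  = d≡1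
  ... | inj₂ refl = contradiction d∣a p∤a

  factorial-invertible : Prime p → ∀ N → N ℕ.< p → ∃[ w ] (w * + (N !) ≈ 1ℤ)
  factorial-invertible p-prime N N<p = coprime⇒invertible (prime∤⇒coprime p-prime (prime∤factorial p-prime N N<p))

  top-coordinate : ∀ ss w → w * + (length ss !) ≈ 1ℤ →
    ∃[ c ] ∀ x → rootProduct ss x ≈ 0ℤ → + (x C length ss) ≈ binomialSum (length ss) c x
  top-coordinate ss w wF≈1 with rootProduct-expansion ss
  ... | d , expansion = (λ t → - w * d t) , lowerCombination
    where
    N = length ss
    F = + (N !)
    lowerCombination : ∀ x → rootProduct ss x ≈ 0ℤ → + (x C N) ≈ binomialSum N (λ t → - w * d t) x
    lowerCombination x P≈0 = begin
      b                                  ≡⟨ ℤ.*-identityˡ b ⟨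
      1ℤ * b                             ≈⟨ *-congʳ b wF≈1 ⟨
      w * F * b                          ≡⟨ ℤ.*-assoc w F b ⟩
      w * (F * b)                        ≡⟨ cong (w *_) (isolate (F * b) S) ⟩
      w * ((F * b + S) - S)              ≡⟨ cong (λ P → w * (P - S)) (expansion x) ⟨
      w * (rootProduct ss x - S)         ≈⟨ *-congˡ w (+-cong P≈0 ≈-refl) ⟩
      w * (0ℤ - S)                       ≡⟨ negate w S ⟩
      - w * S                            ≡⟨ binomialSum-scale N (- w) d x ⟨
      binomialSum N (λ t → - w * d t) x  ∎
      where
      open ≈-Reasoning
      b = + (x C N)
      S = binomialSum N d x
      isolate : ∀ a s → a ≡ (a + s) - s
      isolate = ℤ-Ring.solve-∀
      negate : ∀ w s → w * (0ℤ - s) ≡ - w * s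
      negate = ℤ-Ring.solve-∀

module Counting where

  open import Data.Nat as ℕ using (zero; suc; _+_; _*_; _≤_; _≡ᵇ_; z≤n; s≤s)
  import Data.Nat.Properties as ℕ
  open import Data.Nat.Combinatorics using (_C_; nCk+nC[k+1]≡[n+1]C[k+1])
  open import Data.Bool using (Bool; true; false; _∧_; if_then_else_)
  open import Data.Bool.Properties using (∧-zeroʳ)
  open import Data.Fin.Subset using (Subset; inside; outside; _⊆_; _∩_; _─_; ∣_∣)
  open import Data.Fin.Subset.Properties using (_⊆?_; drop-∷-⊆; ⊆-trans; ⊆-antisym; p∩q⊆p; x∈p∩q⁺; p⊆q⇒∣p∣≤∣q∣)
  open import Data.Vec using ([]; _∷_; here)
  open import Data.List using (List; []; _∷_; _++_; map)
  open import Data.Product using (_,_)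
  open import Data.Empty using (⊥-elim)
  open import Function using (_∘_)
  open import Relation.Nullary using (does; yes; no; ¬_; contradiction)
  open import Relation.Nullary.Decidable using (dec-false)
  open import Relation.Binary.PropositionalEquality
    using (_≡_; _≢_; refl; sym; trans; subst; cong; cong₂; module ≡-Reasoning)

  private variable m n : ℕ

  countIn : List (Subset n) → (Subset n → Bool) → ℕ
  countIn []       f = 0
  countIn (H ∷ Hs) f = if f H then suc (countIn Hs f) else countIn Hs f

  count : (Subset n → Bool) → ℕ
  count {n} f = countIn (allSubsets n) f

  countIn-++ : ∀ (Hs Gs : List (Subset n)) f → countIn (Hs ++ Gs) f ≡ countIn Hs f + countIn Gs f
  countIn-++ []       Gs f = refl
  countIn-++ (H ∷ Hs) Gs f with f H
  ... | true  = cong suc (countIn-++ Hs Gs f)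
  ... | false = countIn-++ Hs Gs f

  countIn-map : ∀ (g : Subset m → Subset n) Hs f → countIn (map g Hs) f ≡ countIn Hs (f ∘ g)
  countIn-map g []       f = refl
  countIn-map g (H ∷ Hs) f with f (g H)
  ... | true  = cong suc (countIn-map g Hs f)
  ... | false = countIn-map g Hs f

  countIn-cong : ∀ (Hs : List (Subset n)) {f g} → (∀ H → f H ≡ g H) → countIn Hs f ≡ countIn Hs g
  countIn-cong []       f≗g = refl
  countIn-cong (H ∷ Hs) f≗g = cong₂ (λ b c → if b then suc c else c) (f≗g H) (countIn-cong Hs f≗g)

  countIn-none : ∀ (Hs : List (Subset n)) → countIn Hs (λ _ → false) ≡ 0
  countIn-none []       = refl
  countIn-none (H ∷ Hs) = countIn-none Hs

  count-none : ∀ {f : Subset n → Bool} → (∀ H → f H ≡ false) → count f ≡ 0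
  count-none {n} f≗false = trans (countIn-cong (allSubsets n) f≗false) (countIn-none (allSubsets n))

  count-suc : ∀ (f : Subset (suc n) → Bool) → count f ≡ count (f ∘ (outside ∷_)) + count (f ∘ (inside ∷_))
  count-suc {n} f = begin
    countIn (map (outside ∷_) (allSubsets n) ++ map (inside ∷_) (allSubsets n)) f
      ≡⟨ countIn-++ (map (outside ∷_) (allSubsets n)) _ f ⟩
    countIn (map (outside ∷_) (allSubsets n)) f + countIn (map (inside ∷_) (allSubsets n)) f
      ≡⟨ cong₂ _+_ (countIn-map (outside ∷_) (allSubsets n) f) (countIn-map (inside ∷_) (allSubsets n) f) ⟩
    count (f ∘ (outside ∷_)) + count (f ∘ (inside ∷_)) ∎
    where open ≡-Reasoning

  between : Subset n → Subset n → ℕ → Subset n → Bool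
  between I E c H = does (I ⊆? H) ∧ (does (H ⊆? E) ∧ (∣ H ∣ ≡ᵇ c))

  count-between : ∀ (I E : Subset n) → I ⊆ E → ∀ t → count (between I E (∣ I ∣ + t)) ≡ ∣ E ─ I ∣ C t
  count-between []            []            _    zero    = refl
  count-between []            []            _    (suc t) = refl
  count-between {suc n} (inside ∷ I)  (outside ∷ E) I⊆E t       = contradiction (I⊆E here) λ ()
  count-between {suc n} (inside ∷ I)  (inside ∷ E)  I⊆E t       = begin
    count (between (inside ∷ I) (inside ∷ E) (suc (∣ I ∣ + t)))
      ≡⟨ count-suc {n} _ ⟩
    count {n} (λ _ → false) + count (between I E (∣ I ∣ + t))
      ≡⟨ cong (_+ count (between I E (∣ I ∣ + t))) (countIn-none (allSubsets n)) ⟩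
    count (between I E (∣ I ∣ + t))
      ≡⟨ count-between I E (drop-∷-⊆ I⊆E) t ⟩
    ∣ E ─ I ∣ C t ∎
    where open ≡-Reasoning
  count-between {suc n} (outside ∷ I) (outside ∷ E) I⊆E t       = begin
    count (between (outside ∷ I) (outside ∷ E) (∣ I ∣ + t))
      ≡⟨ count-suc {n} _ ⟩
    count (between I E (∣ I ∣ + t)) + count (λ H → does (I ⊆? H) ∧ (false ∧ (suc ∣ H ∣ ≡ᵇ ∣ I ∣ + t)))
      ≡⟨ cong₂ _+_ (count-between I E (drop-∷-⊆ I⊆E) t) (count-none (λ H → ∧-zeroʳ (does (I ⊆? H)))) ⟩
    ∣ E ─ I ∣ C t + 0
      ≡⟨ ℕ.+-identityʳ _ ⟩
    ∣ E ─ I ∣ C t ∎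
    where open ≡-Reasoning
  count-between {suc n} (outside ∷ I) (inside ∷ E)  I⊆E zero    = begin
    count (between (outside ∷ I) (inside ∷ E) (∣ I ∣ + 0))
      ≡⟨ count-suc {n} _ ⟩
    count (between I E (∣ I ∣ + 0)) + count (λ H → does (I ⊆? H) ∧ (does (H ⊆? E) ∧ (suc ∣ H ∣ ≡ᵇ ∣ I ∣ + 0)))
      ≡⟨ cong₂ _+_ (count-between I E (drop-∷-⊆ I⊆E) 0) (count-none tooLarge) ⟩
    1 + 0 ∎
    where
    open ≡-Reasoning
    -- a superset of I cannot be smaller than I
    tooLarge : ∀ H → does (I ⊆? H) ∧ (does (H ⊆? E) ∧ (suc ∣ H ∣ ≡ᵇ ∣ I ∣ + 0)) ≡ false
    tooLarge H with I ⊆? H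
    ... | no  _   = refl
    ... | yes I⊆H = trans (cong (does (H ⊆? E) ∧_) (dec-false (suc ∣ H ∣ ℕ.≟ ∣ I ∣ + 0) notSmaller)) (∧-zeroʳ _)
      where
      notSmaller : suc ∣ H ∣ ≢ ∣ I ∣ + 0
      notSmaller eq = ℕ.n≮n ∣ H ∣ (subst (_≤ ∣ H ∣) (sym (trans eq (ℕ.+-identityʳ ∣ I ∣))) (p⊆q⇒∣p∣≤∣q∣ I⊆H))
  count-between {suc n} (outside ∷ I) (inside ∷ E)  I⊆E (suc t) = begin
    count (between (outside ∷ I) (inside ∷ E) (∣ I ∣ + suc t))
      ≡⟨ count-suc {n} _ ⟩
    count (between I E (∣ I ∣ + suc t)) + count (λ H → does (I ⊆? H) ∧ (does (H ⊆? E) ∧ (suc ∣ H ∣ ≡ᵇ ∣ I ∣ + suc t)))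
      ≡⟨ cong (count (between I E (∣ I ∣ + suc t)) +_) (countIn-cong (allSubsets n) λ H → cong (λ c → does (I ⊆? H) ∧ (does (H ⊆? E) ∧ (suc ∣ H ∣ ≡ᵇ c))) (ℕ.+-suc ∣ I ∣ t)) ⟩
    count (between I E (∣ I ∣ + suc t)) + count (between I E (∣ I ∣ + t))
      ≡⟨ cong₂ _+_ (count-between I E (drop-∷-⊆ I⊆E) (suc t)) (count-between I E (drop-∷-⊆ I⊆E) t) ⟩
    ∣ E ─ I ∣ C suc t + ∣ E ─ I ∣ C t
      ≡⟨ ℕ.+-comm (∣ E ─ I ∣ C suc t) _ ⟩
    ∣ E ─ I ∣ C t + ∣ E ─ I ∣ C suc t
      ≡⟨ nCk+nC[k+1]≡[n+1]C[k+1] ∣ E ─ I ∣ t ⟩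
    suc ∣ E ─ I ∣ C suc t ∎
    where open ≡-Reasoning

  count-between-empty : ∀ (I E : Subset n) c → ¬ I ⊆ E → count (between I E c) ≡ 0
  count-between-empty I E c I⊈E = count-none empty
    where
    empty : ∀ H → between I E c H ≡ false
    empty H with I ⊆? H | H ⊆? E
    ... | no  _   | _       = refl
    ... | yes _   | no  _   = refl
    ... | yes I⊆H | yes H⊆E = ⊥-elim (I⊈E (⊆-trans I⊆H H⊆E))

  size-split : ∀ (Y B : Subset n) → ∣ Y ∩ B ∣ + ∣ B ─ Y ∣ ≡ ∣ B ∣
  size-split []            []            = refl
  size-split (inside ∷ Y)  (inside ∷ B)  = cong suc (size-split Y B)
  size-split (inside ∷ Y)  (outside ∷ B) = size-split Y B
  size-split (outside ∷ Y) (inside ∷ B)  = trans (ℕ.+-suc ∣ Y ∩ B ∣ ∣ B ─ Y ∣) (cong suc (size-split Y B))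
  size-split (outside ∷ Y) (outside ∷ B) = size-split Y B

  size-interval : ∀ {I E : Subset n} → I ⊆ E → ∣ I ∣ + ∣ E ─ I ∣ ≡ ∣ E ∣
  size-interval {I = I} {E} I⊆E = trans (cong (λ J → ∣ J ∣ + ∣ E ─ I ∣) (sym I∩E≡I)) (size-split I E)
    where
    I∩E≡I : I ∩ E ≡ I
    I∩E≡I = ⊆-antisym (p∩q⊆p I E) (λ x∈I → x∈p∩q⁺ (x∈I , I⊆E x∈I))

  -- X n = [n-1] misses exactly one element of [n] (for n ≥ 1), so a set has
  -- at most one element outside X n.
  beyondX≤1 : ∀ n (B : Subset n) → ∣ B ─ X n ∣ ≤ 1
  beyondX≤1 zero          []            = z≤n
  beyondX≤1 (suc zero)    (inside ∷ [])  = s≤s z≤n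
  beyondX≤1 (suc zero)    (outside ∷ []) = z≤n
  beyondX≤1 (suc (suc n)) (b ∷ B)        = beyondX≤1 (suc n) B

  beyondX-∩ : ∀ n (B C : Subset n) → ∣ (B ∩ C) ─ X n ∣ ≡ ∣ B ─ X n ∣ * ∣ C ─ X n ∣
  beyondX-∩ zero          []            []       = refl
  beyondX-∩ (suc zero)    (inside ∷ [])  (c ∷ []) = sym (ℕ.+-identityʳ ∣ c ∷ [] ∣)
  beyondX-∩ (suc zero)    (outside ∷ []) (c ∷ []) = refl
  beyondX-∩ (suc (suc n)) (b ∷ B)        (c ∷ C)  = beyondX-∩ (suc n) B C

module LinearForms where

  open import Data.Nat as ℕ using (zero; suc)
  open import Data.Nat.Combinatorics using (_C_)
  open import Data.Integer as ℤ using (ℤ; +_; _+_; _*_; 0ℤ; 1ℤ)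
  import Data.Integer.Properties as ℤ
  import Data.Integer.Tactic.RingSolver as ℤ-Ring
  open import Algebra.Definitions.RawMonoid ℤ.+-0-rawMonoid using (sum)
  open import Data.Bool using (true; false; _∧_; if_then_else_)
  open import Data.Bool.Properties using (∧-zeroʳ; ∧-identityʳ)
  open import Data.Fin as Fin using (Fin)
  open import Data.Fin.Subset using (Subset; _⊆_; _∩_; _─_; ∣_∣; ⊥)
  open import Data.Fin.Subset.Properties using (_⊆?_; p∩q⊆p; p∩q⊆q; x∈p∩q⁺; ⊥⊆; p─⊥≡p; ∣⊥∣≡0)
  open import Data.List as List using (List; []; _∷_; _++_; map; filter; concat)
  open import Data.List.Relation.Unary.All using (All)
  import Data.List.Relation.Unary.All as All
  import Data.List.Relation.Unary.All.Properties as All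
  open import Data.Product using (_×_; _,_; proj₁)
  open import Function using (_∘_)
  open import Level using (0ℓ)
  open import Relation.Nullary using (does; yes; no; contradiction)
  open import Relation.Nullary.Decidable using (_×-dec_)
  open import Relation.Unary using (Pred; Decidable)
  open import Relation.Binary.PropositionalEquality
    using (_≡_; refl; sym; trans; cong; cong₂; module ≡-Reasoning)
  open Counting using (countIn; count; countIn-cong; between; count-between)

  private variable m n : ℕ

  sumForms-coordinate : ∀ (A : Fin m → Subset n) Hs k → sumForms A Hs k ≡ + countIn Hs (λ H → does (H ⊆? A k))
  sumForms-coordinate A []       k = refl
  sumForms-coordinate A (H ∷ Hs) k with does (H ⊆? A k)
  ... | true  = cong (λ c → 1ℤ + c) (sumForms-coordinate A Hs k)
  ... | false = cong (λ c → 0ℤ + c) (sumForms-coordinate A Hs k)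

  countIn-filter : ∀ {P : Pred (Subset n) 0ℓ} (P? : Decidable P) Hs f →
    countIn (filter P? Hs) f ≡ countIn Hs (λ H → does (P? H) ∧ f H)
  countIn-filter P? []       f = refl
  countIn-filter P? (H ∷ Hs) f with does (P? H)
  ... | true  = cong (λ c → if f H then suc c else c) (countIn-filter P? Hs f)
  ... | false = countIn-filter P? Hs f

  -- Layer c of the interval [I, D]: the sets H with H ⊆ D, |H| = c and I ⊆ H,
  -- selected by the decision procedure used in the statement of the theorem.
  layer? : ∀ (D I : Subset n) c → Decidable (λ H → H ⊆ D × (∣ H ∣ ≡ c × I ⊆ H))
  layer? D I c H = (H ⊆? D) ×-dec ((∣ H ∣ ℕ.≟ c) ×-dec (I ⊆? H))

  layer : Subset n → Subset n → ℕ → List (Subset n)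
  layer {n} D I c = filter (layer? D I c) (allSubsets n)

  ⊆?-∩ : ∀ (H D B : Subset n) → does (H ⊆? D) ∧ does (H ⊆? B) ≡ does (H ⊆? D ∩ B)
  ⊆?-∩ H D B with H ⊆? D | H ⊆? B | H ⊆? D ∩ B
  ... | yes _   | yes _   | yes _    = refl
  ... | yes H⊆D | yes H⊆B | no  H⊈DB = contradiction (λ {x} x∈H → x∈p∩q⁺ (H⊆D x∈H , H⊆B x∈H)) H⊈DB
  ... | yes _   | no  H⊈B | yes H⊆DB = contradiction (λ {x} x∈H → p∩q⊆q D B (H⊆DB x∈H)) H⊈B
  ... | yes _   | no  _   | no  _    = refl
  ... | no  H⊈D | _       | yes H⊆DB = contradiction (λ {x} x∈H → p∩q⊆p D B (H⊆DB x∈H)) H⊈D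
  ... | no  _   | _       | no  _    = refl

  layer-coordinate : ∀ (A : Fin m → Subset n) D I c k → sumForms A (layer D I c) k ≡ + count (between I (D ∩ A k) c)
  layer-coordinate {n = n} A D I c k = begin
    sumForms A (layer D I c) k
      ≡⟨ sumForms-coordinate A (layer D I c) k ⟩
    + countIn (layer D I c) (λ H → does (H ⊆? A k))
      ≡⟨ cong +_ (countIn-filter (layer? D I c) (allSubsets n) _) ⟩
    + countIn (allSubsets n) (λ H → (does (H ⊆? D) ∧ ((∣ H ∣ ℕ.≡ᵇ c) ∧ does (I ⊆? H))) ∧ does (H ⊆? A k))
      ≡⟨ cong +_ (countIn-cong (allSubsets n) reorder) ⟩
    + count (between I (D ∩ A k) c) ∎
    where
    open ≡-Reasoning
    shuffle : ∀ a s i b → (a ∧ (s ∧ i)) ∧ b ≡ i ∧ ((a ∧ b) ∧ s)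
    shuffle false s     i b = sym (∧-zeroʳ i)
    shuffle true  false i b = sym (trans (cong (i ∧_) (∧-zeroʳ b)) (∧-zeroʳ i))
    shuffle true  true  i b = cong (i ∧_) (sym (∧-identityʳ b))
    reorder : ∀ H → (does (H ⊆? D) ∧ ((∣ H ∣ ℕ.≡ᵇ c) ∧ does (I ⊆? H))) ∧ does (H ⊆? A k) ≡ between I (D ∩ A k) c H
    reorder H = trans (shuffle (does (H ⊆? D)) (∣ H ∣ ℕ.≡ᵇ c) (does (I ⊆? H)) (does (H ⊆? A k)))
                      (cong (λ b → does (I ⊆? H) ∧ (b ∧ (∣ H ∣ ℕ.≡ᵇ c))) (⊆?-∩ H D (A k)))

  weighted : ℤ → List (Subset n) → List (Subset n × ℤ)
  weighted c Hs = map (λ H → (H , c)) Hs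

  linComb-++ : ∀ (A : Fin m → Subset n) xs ys k → linComb A (xs ++ ys) k ≡ linComb A xs k + linComb A ys k
  linComb-++ A []              ys k = sym (ℤ.+-identityˡ (linComb A ys k))
  linComb-++ A ((H , c) ∷ xs) ys k = trans (cong (λ z → c * Lform A H k + z) (linComb-++ A xs ys k))
                                           (sym (ℤ.+-assoc (c * Lform A H k) (linComb A xs k) (linComb A ys k)))

  linComb-weighted : ∀ (A : Fin m → Subset n) c Hs k → linComb A (weighted c Hs) k ≡ c * sumForms A Hs k
  linComb-weighted A c []       k = sym (ℤ.*-zeroʳ c)
  linComb-weighted A c (H ∷ Hs) k = trans (cong (λ z → c * Lform A H k + z) (linComb-weighted A c Hs k))
                                          (sym (ℤ.*-distribˡ-+ c (Lform A H k) (sumForms A Hs k)))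

  weighted-layer-coordinate : ∀ (A : Fin m → Subset n) w D I c k →
    linComb A (weighted w (layer D I c)) k ≡ w * + count (between I (D ∩ A k) c)
  weighted-layer-coordinate A w D I c k =
    trans (linComb-weighted A w (layer D I c) k) (cong (w *_) (layer-coordinate A D I c k))

  SizeWindow : Subset n → ℕ → ℕ → Subset n → Set
  SizeWindow Y lo hi H = H ⊆ Y × lo ℕ.≤ ∣ H ∣ × ∣ H ∣ ℕ.< hi

  layer-inWindow : ∀ {Y D : Subset n} {lo hi c} w I → D ⊆ Y → lo ℕ.≤ c → c ℕ.< hi →
    All (λ Hc → SizeWindow Y lo hi (proj₁ Hc)) (weighted w (layer D I c))
  layer-inWindow {n} {Y} {D} {lo} {hi} {c} w I D⊆Y lo≤c c<hi =
    All.map⁺ (All.map inWindow (All.all-filter (layer? D I c) (allSubsets n)))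
    where
    inWindow : ∀ {H} → H ⊆ D × (∣ H ∣ ≡ c × I ⊆ H) → SizeWindow Y lo hi H
    inWindow (H⊆D , refl , _) = (λ x∈H → D⊆Y (H⊆D x∈H)) , lo≤c , c<hi

  scale : ℤ → List (Subset n × ℤ) → List (Subset n × ℤ)
  scale c = map (λ (H , d) → (H , c * d))

  linComb-scale : ∀ (A : Fin m → Subset n) c cs k → linComb A (scale c cs) k ≡ c * linComb A cs k
  linComb-scale A c []             k = sym (ℤ.*-zeroʳ c)
  linComb-scale A c ((H , d) ∷ cs) k = trans (cong (λ z → c * d * Lform A H k + z) (linComb-scale A c cs k))
                                             (factor c d (Lform A H k) (linComb A cs k))
    where
    factor : ∀ c d x s → c * d * x + c * s ≡ c * (d * x + s)
    factor = ℤ-Ring.solve-∀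

  linComb-concat : ∀ (A : Fin m → Subset n) {r} (g : Fin r → List (Subset n × ℤ)) k →
    linComb A (concat (List.tabulate g)) k ≡ sum (λ j → linComb A (g j) k)
  linComb-concat A {zero}  g k = refl
  linComb-concat A {suc r} g k = trans (linComb-++ A (g Fin.zero) _ k)
                                       (cong (λ z → linComb A (g Fin.zero) k + z) (linComb-concat A (g ∘ Fin.suc) k))

  layer∅-coordinate : ∀ (A : Fin m → Subset n) D t k → sumForms A (layer D ⊥ t) k ≡ + (∣ D ∩ A k ∣ C t)
  layer∅-coordinate {n = n} A D t k = begin
    sumForms A (layer D ⊥ t) k                 ≡⟨ layer-coordinate A D ⊥ t k ⟩
    + count (between ⊥ (D ∩ A k) t)            ≡⟨ cong (λ c → + count (between ⊥ (D ∩ A k) c)) (cong (ℕ._+ t) (∣⊥∣≡0 n)) ⟨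
    + count (between ⊥ (D ∩ A k) (∣ ⊥ {n} ∣ ℕ.+ t)) ≡⟨ cong +_ (count-between ⊥ (D ∩ A k) ⊥⊆ t) ⟩
    + (∣ (D ∩ A k) ─ ⊥ ∣ C t)                  ≡⟨ cong (λ E → + (∣ E ∣ C t)) (p─⊥≡p (D ∩ A k)) ⟩
    + (∣ D ∩ A k ∣ C t)                        ∎
    where open ≡-Reasoning

module LayerReduction where

  open import Data.Nat as ℕ using (zero; suc)
  import Data.Nat.Properties as ℕ
  open import Data.Nat.Combinatorics using (_C_)
  open import Data.Nat.Primality using (Prime)
  open import Data.Integer as ℤ using (ℤ; +_; _+_; _*_; _-_; -_; 0ℤ)
  import Data.Integer.Properties as ℤ
  import Data.Integer.Tactic.RingSolver as ℤ-Ring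
  open import Data.Fin as Fin using (Fin; toℕ)
  open import Data.Fin.Subset using (Subset; inside; outside; _∈_; _⊆_; _∩_; _─_; ∣_∣)
  open import Data.Fin.Subset.Properties using (_⊆?_)
  open import Data.Vec using ([]; _∷_; here; there)
  open import Data.List using (List; []; _∷_; _++_; length)
  import Data.List.Membership.Propositional as List
  open import Data.List.Relation.Unary.Any using (here; there)
  open import Data.List.Relation.Unary.All using (All)
  import Data.List.Relation.Unary.All.Properties as All
  open import Data.Product using (∃-syntax; _×_; _,_; proj₁)
  open import Function using (_∘_)
  open import Relation.Nullary using (¬_; yes; no)
  open import Relation.Binary.PropositionalEquality
    using (_≡_; refl; sym; trans; cong; cong₂; module ≡-Reasoning)
  open BinomialBasis
  open Counting using (count; between; count-between; count-between-empty; size-split; size-interval; beyondX≤1)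
  open LinearForms

  private variable m n : ℕ

  layers : Subset n → Subset n → ℕ → (ℕ → ℤ) → List (Subset n × ℤ)
  layers D I zero    c = []
  layers D I (suc N) c = layers D I N c ++ weighted (c N) (layer D I (∣ I ∣ ℕ.+ N))

  layers-coordinate : ∀ (A : Fin m → Subset n) D I N c k → I ⊆ D ∩ A k →
    linComb A (layers D I N c) k ≡ binomialSum N c ∣ (D ∩ A k) ─ I ∣
  layers-coordinate A D I zero    c k I⊆E = refl
  layers-coordinate A D I (suc N) c k I⊆E = begin
    linComb A (layers D I N c ++ weighted (c N) (layer D I (∣ I ∣ ℕ.+ N))) k
      ≡⟨ linComb-++ A (layers D I N c) _ k ⟩
    linComb A (layers D I N c) k + linComb A (weighted (c N) (layer D I (∣ I ∣ ℕ.+ N))) k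
      ≡⟨ cong₂ _+_ (layers-coordinate A D I N c k I⊆E) (weighted-layer-coordinate A (c N) D I _ k) ⟩
    binomialSum N c f + c N * + count (between I (D ∩ A k) (∣ I ∣ ℕ.+ N))
      ≡⟨ cong (λ z → binomialSum N c f + c N * + z) (count-between I (D ∩ A k) I⊆E N) ⟩
    binomialSum N c f + c N * + (f C N) ∎
    where
    open ≡-Reasoning
    f = ∣ (D ∩ A k) ─ I ∣

  layers-coordinate-empty : ∀ (A : Fin m → Subset n) D I N c k → ¬ I ⊆ D ∩ A k → linComb A (layers D I N c) k ≡ 0ℤ
  layers-coordinate-empty A D I zero    c k I⊈E = refl
  layers-coordinate-empty A D I (suc N) c k I⊈E = begin
    linComb A (layers D I N c ++ weighted (c N) (layer D I (∣ I ∣ ℕ.+ N))) k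
      ≡⟨ linComb-++ A (layers D I N c) _ k ⟩
    linComb A (layers D I N c) k + linComb A (weighted (c N) (layer D I (∣ I ∣ ℕ.+ N))) k
      ≡⟨ cong₂ _+_ (layers-coordinate-empty A D I N c k I⊈E) (weighted-layer-coordinate A (c N) D I _ k) ⟩
    0ℤ + c N * + count (between I (D ∩ A k) (∣ I ∣ ℕ.+ N))
      ≡⟨ cong (λ z → 0ℤ + c N * + z) (count-between-empty I (D ∩ A k) _ I⊈E) ⟩
    0ℤ + c N * 0ℤ
      ≡⟨ cong (λ z → 0ℤ + z) (ℤ.*-zeroʳ (c N)) ⟩
    0ℤ ∎
    where open ≡-Reasoning

  layers-inWindow : ∀ (D I : Subset n) N {M} c → N ℕ.≤ M → All (λ Hc → SizeWindow D ∣ I ∣ (∣ I ∣ ℕ.+ M) (proj₁ Hc)) (layers D I N c)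
  layers-inWindow D I zero    c _   = All.[]
  layers-inWindow D I (suc N) c N<M = All.++⁺ (layers-inWindow D I N c (ℕ.<⇒≤ N<M))
    (layer-inWindow (c N) I (λ x∈D → x∈D) (ℕ.m≤m+n ∣ I ∣ N) (ℕ.+-monoʳ-< ∣ I ∣ N<M))

  layer-reduction : ∀ {p} (A : Fin m → Subset n) (D I : Subset n) N c →
    (∀ k → I ⊆ D ∩ A k → Congruence._≈_ p (+ (∣ (D ∩ A k) ─ I ∣ C N)) (binomialSum N c ∣ (D ∩ A k) ─ I ∣)) →
    InSpan p A (SizeWindow D ∣ I ∣ (∣ I ∣ ℕ.+ N)) (sumForms A (layer D I (∣ I ∣ ℕ.+ N)))
  layer-reduction {p = p} A D I N c top =
    layers D I N c , layers-inWindow D I N c ℕ.≤-refl , λ k → ≈⇒≡[mod] (coordinate k)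
    where
    open Congruence p
    coordinate : ∀ k → sumForms A (layer D I (∣ I ∣ ℕ.+ N)) k ≈ linComb A (layers D I N c) k
    coordinate k with I ⊆? D ∩ A k
    ... | yes I⊆E = begin
      sumForms A (layer D I (∣ I ∣ ℕ.+ N)) k          ≡⟨ layer-coordinate A D I (∣ I ∣ ℕ.+ N) k ⟩
      + count (between I (D ∩ A k) (∣ I ∣ ℕ.+ N))     ≡⟨ cong +_ (count-between I (D ∩ A k) I⊆E N) ⟩
      + (∣ (D ∩ A k) ─ I ∣ C N)                        ≈⟨ top k I⊆E ⟩
      binomialSum N c ∣ (D ∩ A k) ─ I ∣                ≡⟨ layers-coordinate A D I N c k I⊆E ⟨
      linComb A (layers D I N c) k                     ∎
      where open ≈-Reasoning
    ... | no I⊈E = ≈-reflexive (begin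
      sumForms A (layer D I (∣ I ∣ ℕ.+ N)) k          ≡⟨ layer-coordinate A D I (∣ I ∣ ℕ.+ N) k ⟩
      + count (between I (D ∩ A k) (∣ I ∣ ℕ.+ N))     ≡⟨ cong +_ (count-between-empty I (D ∩ A k) (∣ I ∣ ℕ.+ N) I⊈E) ⟩
      0ℤ                                               ≡⟨ layers-coordinate-empty A D I N c k I⊈E ⟨
      linComb A (layers D I N c) k                     ∎)
      where open ≡-Reasoning

  -- Suppose every size f_k = |(D ∩ A_k) ─ I| (for I ⊆ A_k) is, modulo a prime p, a root
  -- of a monic integer polynomial of degree N < p.  Writing the polynomial in the binomial
  -- basis and dividing by N! expresses C(f_k, N) through the C(f_k, t), t < N.
  root-reduction : ∀ {p} → Prime p → (A : Fin m → Subset n) (D I : Subset n) (ss : List ℤ) → length ss ℕ.< p →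
    (∀ k → I ⊆ D ∩ A k → Congruence._≈_ p (rootProduct ss ∣ (D ∩ A k) ─ I ∣) 0ℤ) →
    InSpan p A (SizeWindow D ∣ I ∣ (∣ I ∣ ℕ.+ length ss)) (sumForms A (layer D I (∣ I ∣ ℕ.+ length ss)))
  root-reduction {p = p} p-prime A D I ss N<p roots =
    let (w , wN!≈1) = factorial-invertible p-prime (length ss) N<p
        (c , top)   = top-coordinate ss w wN!≈1
    in layer-reduction A D I (length ss) c (λ k I⊆E → top ∣ (D ∩ A k) ─ I ∣ (roots k I⊆E))
    where open RootsModulo p

  pairedRoots : ∀ {q} → Subset q → (Fin q → ℤ) → List ℤ
  pairedRoots []            v = []
  pairedRoots (inside ∷ K)  v = v Fin.zero - + 0 ∷ v Fin.zero - + 1 ∷ pairedRoots K (v ∘ Fin.suc)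
  pairedRoots (outside ∷ K) v = pairedRoots K (v ∘ Fin.suc)

  pairedRoots-length : ∀ {q} (K : Subset q) v → length (pairedRoots K v) ≡ 2 ℕ.* ∣ K ∣
  pairedRoots-length []            v = refl
  pairedRoots-length (inside ∷ K)  v =
    trans (cong (λ l → suc (suc l)) (pairedRoots-length K (v ∘ Fin.suc))) (sym (ℕ.*-suc 2 ∣ K ∣))
  pairedRoots-length (outside ∷ K) v = pairedRoots-length K (v ∘ Fin.suc)

  pairedRoots-∈ : ∀ {q} (K : Subset q) v {κ} e → κ ∈ K → e ℕ.≤ 1 → v κ - + e List.∈ pairedRoots K v
  pairedRoots-∈ (inside ∷ K)  v .0 here       ℕ.z≤n           = here refl
  pairedRoots-∈ (inside ∷ K)  v .1 here       (ℕ.s≤s ℕ.z≤n)   = there (here refl)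
  pairedRoots-∈ (inside ∷ K)  v e  (there κ∈K) e≤1            = there (there (pairedRoots-∈ K (v ∘ Fin.suc) e κ∈K e≤1))
  pairedRoots-∈ (outside ∷ K) v e  (there κ∈K) e≤1            = pairedRoots-∈ K (v ∘ Fin.suc) e κ∈K e≤1

  -- For I ⊆ X ∩ A_k let e_k = |A_k ─ X| ∈ {0, 1} record
  -- whether n ∈ A_k; then κ ≡ |A_k| = |I| + f_k + e_k for some κ ∈ K, so f_k is a root of
  -- Π_{κ ∈ K} (x - (κ - |I|)) (x - (κ - |I| - 1)), a polynomial of degree 2|K|.
  smallCase : ∀ {p} → Prime p → (K : Subset p) (A : Fin m → Subset n) →
    (∀ j → ∃[ κ ] (κ ∈ K × (+ ∣ A j ∣) ≡ (+ toℕ κ) [mod p ])) → (I : Subset n) → I ⊆ X n → 2 ℕ.* ∣ K ∣ ℕ.< p →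
    InSpan p A (SizeWindow (X n) ∣ I ∣ (∣ I ∣ ℕ.+ 2 ℕ.* ∣ K ∣)) (sumForms A (layer (X n) I (∣ I ∣ ℕ.+ 2 ℕ.* ∣ K ∣)))
  smallCase {n = n} {p = p} p-prime K A sizes I I⊆X 2|K|<p rewrite sym (pairedRoots-length K (λ κ → + toℕ κ - + ∣ I ∣)) =
    root-reduction p-prime A (X n) I roots 2|K|<p rootOf
    where
    open Congruence p
    open RootsModulo p using (rootProduct-root)
    shift : Fin p → ℤ
    shift κ = + toℕ κ - + ∣ I ∣
    roots = pairedRoots K shift
    rootOf : ∀ k → I ⊆ X n ∩ A k → rootProduct roots ∣ (X n ∩ A k) ─ I ∣ ≈ 0ℤ
    rootOf k I⊆E with sizes k
    ... | κ , κ∈K , |A|≡κ = rootProduct-root f (pairedRoots-∈ K shift e κ∈K (beyondX≤1 n (A k))) f≈root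
      where
      f = ∣ (X n ∩ A k) ─ I ∣
      e = ∣ A k ─ X n ∣
      |A|≡i+f+e : ∣ A k ∣ ≡ ∣ I ∣ ℕ.+ f ℕ.+ e
      |A|≡i+f+e = trans (sym (size-split (X n) (A k))) (cong (ℕ._+ e) (sym (size-interval I⊆E)))
      solve-f : ∀ i f e → f ≡ i + f + e - i - e
      solve-f = ℤ-Ring.solve-∀
      f≈root : + f ≈ shift κ - + e
      f≈root = begin
        + f                                   ≡⟨ solve-f (+ ∣ I ∣) (+ f) (+ e) ⟩
        + ∣ I ∣ + + f + + e - + ∣ I ∣ - + e   ≡⟨ cong (λ z → z - + ∣ I ∣ - + e) (trans (cong (_+ + e) (ℤ.pos-+ ∣ I ∣ f)) (ℤ.pos-+ (∣ I ∣ ℕ.+ f) e)) ⟨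
        + (∣ I ∣ ℕ.+ f ℕ.+ e) - + ∣ I ∣ - + e ≡⟨ cong (λ z → + z - + ∣ I ∣ - + e) |A|≡i+f+e ⟨
        + ∣ A k ∣ - + ∣ I ∣ - + e             ≈⟨ +-cong (+-cong (≡[mod]⇒≈ {+ ∣ A k ∣} {+ toℕ κ} |A|≡κ) (≈-refl { - + ∣ I ∣ })) (≈-refl { - + e }) ⟩
        shift κ - + e                         ∎
        where open ≈-Reasoning

-- Here |A_j| ≡ κ and |A_j ∩ A_l| ≡ 1 - κ
-- (j ≠ l) modulo 2.  With a_j = |X ∩ A_j| and e_j = |A_j ─ X| (whether n ∈ A_j), layer 2
-- of [∅, X] has coordinate l equal to C(a_l, 2).  The combinations
--   G_j = Σ_{h ∈ X ∩ A_j} L_{h} + e_j Σ_{h ∈ X} L_{h} - w_j L_∅,   w_j = 1 - κ + κ e_j,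
-- have coordinates G_j(l) ≡ δ_{jl} (mod 2), so Σ_j C(a_j, 2) G_j does the job.
module ParityTwo where

  import Data.Nat as ℕ
  open import Data.Nat.Combinatorics using (_C_; nC1≡n)
  open import Data.Integer as ℤ using (ℤ; +_; _+_; _*_; _-_; -_; 0ℤ; 1ℤ)
  import Data.Integer.Properties as ℤ
  import Data.Integer.Tactic.RingSolver as ℤ-Ring
  open import Algebra.Definitions.RawMonoid ℤ.+-0-rawMonoid using (sum)
  open import Data.Fin using (Fin)
  open import Data.Fin.Subset using (Subset; _∩_; _─_; ∣_∣; ⊥)
  open import Data.Fin.Subset.Properties using (∩-assoc; ∩-idem; p∩q⊆p)
  open import Data.List as List using (List; _++_; concat)
  open import Data.List.Relation.Unary.All using (All)
  import Data.List.Relation.Unary.All.Properties as All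
  open import Data.Product using (_×_; _,_; proj₁)
  open import Relation.Binary.PropositionalEquality
    using (_≡_; _≢_; sym; trans; cong; cong₂; module ≡-Reasoning)
  open Counting using (size-split; beyondX-∩)
  open LinearForms

  module _ {m n : ℕ} (A : Fin m → Subset n) (κ : ℤ)
    (sizes : ∀ j → Congruence._≈_ 2 (+ ∣ A j ∣) κ)
    (intersections : ∀ j l → j ≢ l → Congruence._≈_ 2 (+ ∣ A j ∩ A l ∣) (1ℤ - κ)) where

    open Congruence 2

    a e : Fin m → ℕ
    a j = ∣ X n ∩ A j ∣
    e j = ∣ A j ─ X n ∣

    w : Fin m → ℤ
    w j = 1ℤ - κ + κ * + e j

    G : Fin m → List (Subset n × ℤ)
    G j = weighted 1ℤ (layer (X n ∩ A j) ⊥ 1) ++ weighted (+ e j) (layer (X n) ⊥ 1) ++ weighted (- w j) (layer (X n) ⊥ 0)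

    gram : Fin m → Fin m → ℤ
    gram j l = + ∣ (X n ∩ A j) ∩ A l ∣ + + e j * + a l - w j

    G-coordinate : ∀ j l → linComb A (G j) l ≡ gram j l
    G-coordinate j l = begin
      linComb A (G j) l
        ≡⟨ linComb-++ A (weighted 1ℤ (layer (X n ∩ A j) ⊥ 1)) _ l ⟩
      linComb A (weighted 1ℤ (layer (X n ∩ A j) ⊥ 1)) l + linComb A (weighted (+ e j) (layer (X n) ⊥ 1) ++ weighted (- w j) (layer (X n) ⊥ 0)) l
        ≡⟨ cong₂ _+_ singletonsInside (trans (linComb-++ A (weighted (+ e j) (layer (X n) ⊥ 1)) _ l) (cong₂ _+_ singletonsAll empty)) ⟩
      1ℤ * + ∣ (X n ∩ A j) ∩ A l ∣ + (+ e j * + a l + - w j * 1ℤ)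
        ≡⟨ tidy (+ ∣ (X n ∩ A j) ∩ A l ∣) (+ e j * + a l) (w j) ⟩
      gram j l ∎
      where
      open ≡-Reasoning
      weighted-layer∅ : ∀ c D t → linComb A (weighted c (layer D ⊥ t)) l ≡ c * + (∣ D ∩ A l ∣ C t)
      weighted-layer∅ c D t = trans (linComb-weighted A c (layer D ⊥ t) l) (cong (c *_) (layer∅-coordinate A D t l))
      singletonsInside : linComb A (weighted 1ℤ (layer (X n ∩ A j) ⊥ 1)) l ≡ 1ℤ * + ∣ (X n ∩ A j) ∩ A l ∣
      singletonsInside = trans (weighted-layer∅ 1ℤ (X n ∩ A j) 1) (cong (λ z → 1ℤ * + z) (nC1≡n ∣ (X n ∩ A j) ∩ A l ∣))
      singletonsAll : linComb A (weighted (+ e j) (layer (X n) ⊥ 1)) l ≡ + e j * + a l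
      singletonsAll = trans (weighted-layer∅ (+ e j) (X n) 1) (cong (λ z → + e j * + z) (nC1≡n (a l)))
      empty : linComb A (weighted (- w j) (layer (X n) ⊥ 0)) l ≡ - w j * 1ℤ
      empty = weighted-layer∅ (- w j) (X n) 0
      tidy : ∀ x y w → 1ℤ * x + (y + - w * 1ℤ) ≡ x + y - w
      tidy = ℤ-Ring.solve-∀

    size-A : ∀ l → + ∣ A l ∣ ≡ + a l + + e l
    size-A l = trans (cong +_ (sym (size-split (X n) (A l)))) (ℤ.pos-+ (a l) (e l))

    size-A∩A : ∀ j l → + ∣ A j ∩ A l ∣ ≡ + ∣ (X n ∩ A j) ∩ A l ∣ + + e j * + e l
    size-A∩A j l = begin
      + ∣ A j ∩ A l ∣                                              ≡⟨ cong +_ (size-split (X n) (A j ∩ A l)) ⟨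
      + (∣ X n ∩ (A j ∩ A l) ∣ ℕ.+ ∣ (A j ∩ A l) ─ X n ∣)         ≡⟨ cong₂ (λ B C → + (∣ B ∣ ℕ.+ C)) (sym (∩-assoc (X n) (A j) (A l))) (beyondX-∩ n (A j) (A l)) ⟩
      + (∣ (X n ∩ A j) ∩ A l ∣ ℕ.+ e j ℕ.* e l)                   ≡⟨ ℤ.pos-+ ∣ (X n ∩ A j) ∩ A l ∣ (e j ℕ.* e l) ⟩
      + ∣ (X n ∩ A j) ∩ A l ∣ + + (e j ℕ.* e l)                   ≡⟨ cong (λ z → + ∣ (X n ∩ A j) ∩ A l ∣ + z) (ℤ.pos-* (e j) (e l)) ⟩
      + ∣ (X n ∩ A j) ∩ A l ∣ + + e j * + e l                     ∎
      where open ≡-Reasoning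

    gram-offDiagonal : ∀ j l → j ≢ l → gram j l ≈ 0ℤ
    gram-offDiagonal j l j≢l = begin
      gram j l
        ≡⟨ regroup (+ ∣ (X n ∩ A j) ∩ A l ∣) (+ a l) (+ e j) (+ e l) κ ⟩
      (+ ∣ (X n ∩ A j) ∩ A l ∣ + + e j * + e l - (1ℤ - κ)) + + e j * (+ a l + + e l - κ) + - (+ e j * + e l) * + 2
        ≡⟨ cong₂ (λ B α → (B - (1ℤ - κ)) + + e j * (α - κ) + - (+ e j * + e l) * + 2) (size-A∩A j l) (size-A l) ⟨
      (+ ∣ A j ∩ A l ∣ - (1ℤ - κ)) + + e j * (+ ∣ A l ∣ - κ) + - (+ e j * + e l) * + 2
        ≈⟨ +-cong (+-cong (difference≈0 (intersections j l j≢l)) (*-congˡ (+ e j) (difference≈0 (sizes l)))) (multiple≈0 (- (+ e j * + e l))) ⟩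
      0ℤ + + e j * 0ℤ + 0ℤ
        ≡⟨ cong (λ z → 0ℤ + z + 0ℤ) (ℤ.*-zeroʳ (+ e j)) ⟩
      0ℤ ∎
      where
      open ≈-Reasoning
      regroup : ∀ y a ej el κ → y + ej * a - (1ℤ - κ + κ * ej) ≡ (y + ej * el - (1ℤ - κ)) + ej * (a + el - κ) + - (ej * el) * + 2
      regroup = ℤ-Ring.solve-∀

    gram-diagonal : ∀ l → gram l l ≈ 1ℤ
    gram-diagonal l = begin
      gram l l
        ≡⟨ regroup (+ ∣ (X n ∩ A l) ∩ A l ∣) (+ a l) (+ e l) κ ⟩
      1ℤ + (+ ∣ (X n ∩ A l) ∩ A l ∣ + + e l * + e l - κ) + + e l * (+ a l + + e l - κ) + (κ - 1ℤ - + e l * + e l) * + 2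
        ≡⟨ cong₂ (λ B α → 1ℤ + (B - κ) + + e l * (α - κ) + (κ - 1ℤ - + e l * + e l) * + 2) (size-A∩A l l) (size-A l) ⟨
      1ℤ + (+ ∣ A l ∩ A l ∣ - κ) + + e l * (+ ∣ A l ∣ - κ) + (κ - 1ℤ - + e l * + e l) * + 2
        ≡⟨ cong (λ B → 1ℤ + (+ ∣ B ∣ - κ) + + e l * (+ ∣ A l ∣ - κ) + (κ - 1ℤ - + e l * + e l) * + 2) (∩-idem (A l)) ⟩
      1ℤ + (+ ∣ A l ∣ - κ) + + e l * (+ ∣ A l ∣ - κ) + (κ - 1ℤ - + e l * + e l) * + 2
        ≈⟨ +-cong (+-cong (+-cong (≈-refl {1ℤ}) (difference≈0 (sizes l))) (*-congˡ (+ e l) (difference≈0 (sizes l)))) (multiple≈0 (κ - 1ℤ - + e l * + e l)) ⟩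
      1ℤ + 0ℤ + + e l * 0ℤ + 0ℤ
        ≡⟨ cong (λ z → 1ℤ + 0ℤ + z + 0ℤ) (ℤ.*-zeroʳ (+ e l)) ⟩
      1ℤ ∎
      where
      open ≈-Reasoning
      regroup : ∀ y a el κ → y + el * a - (1ℤ - κ + κ * el) ≡ 1ℤ + (y + el * el - κ) + el * (a + el - κ) + (κ - 1ℤ - el * el) * + 2
      regroup = ℤ-Ring.solve-∀

    target : Fin m → ℤ
    target j = + (a j C 2)

    combination : List (Subset n × ℤ)
    combination = concat (List.tabulate (λ j → scale (target j) (G j)))

    combination-inWindow : All (λ Hc → SizeWindow (X n) 0 2 (proj₁ Hc)) combination
    combination-inWindow = All.concat⁺ (All.tabulate⁺ λ j → All.map⁺ (G-inWindow j))
      where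
      G-inWindow : ∀ j → All (λ Hc → SizeWindow (X n) 0 2 (proj₁ Hc)) (G j)
      G-inWindow j =
        All.++⁺ (layer-inWindow 1ℤ ⊥ (p∩q⊆p (X n) (A j)) ℕ.z≤n (ℕ.s≤s (ℕ.s≤s ℕ.z≤n)))
       (All.++⁺ (layer-inWindow (+ e j) ⊥ (λ x∈X → x∈X) ℕ.z≤n (ℕ.s≤s (ℕ.s≤s ℕ.z≤n)))
                (layer-inWindow (- w j) ⊥ (λ x∈X → x∈X) ℕ.z≤n (ℕ.s≤s ℕ.z≤n)))

    combination-coordinate : ∀ l → sumForms A (layer (X n) ⊥ 2) l ≈ linComb A combination l
    combination-coordinate l = begin
      sumForms A (layer (X n) ⊥ 2) l               ≡⟨ layer∅-coordinate A (X n) 2 l ⟩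
      target l                                     ≈⟨ sum-concentrated term l vanishes diagonal ⟨
      sum term                                     ≡⟨ linComb-concat A (λ j → scale (target j) (G j)) l ⟨
      linComb A combination l                      ∎
      where
      open ≈-Reasoning
      term : Fin m → ℤ
      term j = linComb A (scale (target j) (G j)) l
      term≡ : ∀ j → term j ≡ target j * gram j l
      term≡ j = trans (linComb-scale A (target j) (G j) l) (cong (target j *_) (G-coordinate j l))
      vanishes : ∀ j → j ≢ l → term j ≈ 0ℤ
      vanishes j j≢l = ≈-trans (≈-reflexive (term≡ j))
        (≈-trans (*-congˡ (target j) (gram-offDiagonal j l j≢l)) (≈-reflexive (ℤ.*-zeroʳ (target j))))
      diagonal : term l ≈ target l
      diagonal = ≈-trans (≈-reflexive (term≡ l))
        (≈-trans (*-congˡ (target l) (gram-diagonal l)) (≈-reflexive (ℤ.*-identityʳ (target l))))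

    parityTwo : InSpan 2 A (SizeWindow (X n) 0 2) (sumForms A (layer (X n) ⊥ 2))
    parityTwo = combination , combination-inWindow , λ l → ≈⇒≡[mod] (combination-coordinate l)

open import Data.Nat using (ℕ; _+_; _*_; _≤_; _<_; _≟_; zero; suc; z≤n; s≤s; _<?_)
import Data.Nat.Properties as ℕ
open import Data.Nat.Base using (nonTrivial⇒n>1)
open import Data.Nat.Primality using (Prime; prime⇒nonTrivial)
open import Data.Integer as ℤ using (+_; 1ℤ)
open import Data.Fin using (Fin; toℕ; zero; suc)
open import Data.Fin.Subset using (Subset; _∈_; _⊆_; _∩_; ∣_∣; inside; outside) renaming (⊥ to ∅)
open import Data.Fin.Subset.Properties using (_⊆?_; ∣⊥∣≡0)
open import Data.Vec using ([]; _∷_; here; there)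
open import Data.Product using (∃-syntax; _×_; _,_)
open import Data.Empty using (⊥; ⊥-elim)
open import Relation.Binary.PropositionalEquality using (_≡_; _≢_; refl; cong; sym; subst)
open import Relation.Nullary using (yes; no; contradiction)
open import Relation.Nullary.Decidable using (_×-dec_)
open LinearForms using (SizeWindow; layer)
open LayerReduction using (smallCase)

disjoint-size : ∀ {n} (K L : Subset n) → ((x : Fin n) → x ∈ K → x ∈ L → ⊥) → ∣ K ∣ + ∣ L ∣ ≤ n
disjoint-size []            []            _        = z≤n
disjoint-size (inside ∷ K)  (inside ∷ L)  disjoint = ⊥-elim (disjoint zero here here)
disjoint-size (inside ∷ K)  (outside ∷ L) disjoint = s≤s (disjoint-size K L λ x x∈K x∈L → disjoint (suc x) (there x∈K) (there x∈L))
disjoint-size {suc n} (outside ∷ K) (inside ∷ L) disjoint =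
  subst (_≤ suc n) (sym (ℕ.+-suc ∣ K ∣ ∣ L ∣)) (s≤s (disjoint-size K L λ x x∈K x∈L → disjoint (suc x) (there x∈K) (there x∈L)))
disjoint-size (outside ∷ K) (outside ∷ L) disjoint =
  ℕ.m≤n⇒m≤1+n (disjoint-size K L λ x x∈K x∈L → disjoint (suc x) (there x∈K) (there x∈L))

few-elements : ∀ {p r s i} → r + s ≤ p → i + 2 * r ≤ s + 1 → p ≤ 2 * r → r + i ≤ 1
few-elements {p} {r} {s} {i} r+s≤p bound p≤2r = ℕ.+-cancelʳ-≤ (2 * r) (r + i) 1 (begin
  r + i + 2 * r    ≡⟨ ℕ.+-assoc r i (2 * r) ⟩
  r + (i + 2 * r)  ≤⟨ ℕ.+-monoʳ-≤ r bound ⟩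
  r + (s + 1)      ≡⟨ ℕ.+-assoc r s 1 ⟨
  r + s + 1        ≤⟨ ℕ.+-monoˡ-≤ 1 r+s≤p ⟩
  p + 1            ≤⟨ ℕ.+-monoˡ-≤ 1 p≤2r ⟩
  2 * r + 1        ≡⟨ ℕ.+-comm (2 * r) 1 ⟩
  1 + 2 * r        ∎)
  where open ℕ.≤-Reasoning

degenerate : ∀ {p r s i} → 2 ≤ p → r + s ≤ p → i + 2 * r ≤ s + 1 → p ≤ 2 * r → p ≡ 2 × r ≡ 1 × i ≡ 0
degenerate {p} {zero}          {s} {i} 2≤p _     _     p≤0 = contradiction (ℕ.≤-trans 2≤p p≤0) λ ()
degenerate {p} {suc zero}      {s} {i} 2≤p r+s≤p bound p≤2 =
  ℕ.≤-antisym p≤2 2≤p , refl , ℕ.n≤0⇒n≡0 (ℕ.≤-pred (few-elements {p} {1} {s} {i} r+s≤p bound p≤2))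
degenerate {p} {suc (suc r)}   {s} {i} 2≤p r+s≤p bound p≤2r =
  contradiction (few-elements {p} {suc (suc r)} {s} {i} r+s≤p bound p≤2r) λ { (s≤s ()) }

∣p∣≡0⇒p≡∅ : ∀ {n} (I : Subset n) → ∣ I ∣ ≡ 0 → I ≡ ∅
∣p∣≡0⇒p≡∅ []            _     = refl
∣p∣≡0⇒p≡∅ (outside ∷ I) |I|≡0 = cong (outside ∷_) (∣p∣≡0⇒p≡∅ I |I|≡0)

-- For p = 2 and K = {κ} the hypotheses fix all parities: |A_j| ≡ κ, and since L is
-- disjoint from K, |A_j ∩ A_l| ≡ 1 - κ for j ≠ l.
parities : ∀ {m n} (K L : Subset 2) → ((x : Fin 2) → x ∈ K → x ∈ L → ⊥) → ∣ K ∣ ≡ 1 → (A : Fin m → Subset n)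
  → ((j : Fin m) → ∃[ k ] (k ∈ K × (+ ∣ A j ∣) ≡ (+ toℕ k) [mod 2 ]))
  → ((j l : Fin m) → j ≢ l → ∃[ l′ ] (l′ ∈ L × (+ ∣ A j ∩ A l ∣) ≡ (+ toℕ l′) [mod 2 ]))
  → ∃[ κ ] ((∀ j → Congruence._≈_ 2 (+ ∣ A j ∣) κ) × (∀ j l → j ≢ l → Congruence._≈_ 2 (+ ∣ A j ∩ A l ∣) (1ℤ ℤ.- κ)))
parities (inside ∷ outside ∷ []) L disjoint _ A sizes intersections = + 0 , size , intersection
  where
  size : ∀ j → Congruence._≈_ 2 (+ ∣ A j ∣) (+ 0)
  size j with sizes j
  ... | zero     , _          , |A|≡0 = Congruence.≡[mod]⇒≈ 2 |A|≡0
  ... | suc zero , there ()   , _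
  intersection : ∀ j l → j ≢ l → Congruence._≈_ 2 (+ ∣ A j ∩ A l ∣) (1ℤ ℤ.- + 0)
  intersection j l j≢l with intersections j l j≢l
  ... | zero     , 0∈L , _     = ⊥-elim (disjoint zero here 0∈L)
  ... | suc zero , _   , |A∩A|≡1 = Congruence.≡[mod]⇒≈ 2 |A∩A|≡1
parities (outside ∷ inside ∷ []) L disjoint _ A sizes intersections = + 1 , size , intersection
  where
  size : ∀ j → Congruence._≈_ 2 (+ ∣ A j ∣) (+ 1)
  size j with sizes j
  ... | zero     , ()         , _
  ... | suc zero , _          , |A|≡1 = Congruence.≡[mod]⇒≈ 2 |A|≡1
  intersection : ∀ j l → j ≢ l → Congruence._≈_ 2 (+ ∣ A j ∩ A l ∣) (1ℤ ℤ.- + 1)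
  intersection j l j≢l with intersections j l j≢l
  ... | zero     , _   , |A∩A|≡0 = Congruence.≡[mod]⇒≈ 2 |A∩A|≡0
  ... | suc zero , 1∈L , _       = ⊥-elim (disjoint (suc zero) (there here) 1∈L)

largeCase : ∀ {m n} (K L : Subset 2) → ((x : Fin 2) → x ∈ K → x ∈ L → ⊥) → ∣ K ∣ ≡ 1 → (A : Fin m → Subset n)
  → ((j : Fin m) → ∃[ k ] (k ∈ K × (+ ∣ A j ∣) ≡ (+ toℕ k) [mod 2 ]))
  → ((j l : Fin m) → j ≢ l → ∃[ l′ ] (l′ ∈ L × (+ ∣ A j ∩ A l ∣) ≡ (+ toℕ l′) [mod 2 ]))
  → (I : Subset n) → ∣ I ∣ ≡ 0
  → InSpan 2 A (SizeWindow (X n) ∣ I ∣ (∣ I ∣ + 2 * ∣ K ∣)) (sumForms A (layer (X n) I (∣ I ∣ + 2 * ∣ K ∣)))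
largeCase {n = n} K L disjoint |K|≡1 A sizes intersections I |I|≡0
  with parities K L disjoint |K|≡1 A sizes intersections
... | κ , sizes≈ , intersections≈
  rewrite ∣p∣≡0⇒p≡∅ I |I|≡0 | ∣⊥∣≡0 n | |K|≡1 = ParityTwo.parityTwo A κ sizes≈ intersections≈

lemma2p2 : (p : ℕ) → Prime p → (K L : Subset p) → ((x : Fin p) → x ∈ K → x ∈ L → ⊥)
    → (n m : ℕ) → (A : Fin m → Subset n)
    → ((i : Fin m) → ∃[ k ] (k ∈ K × (+ ∣ A i ∣) ≡ (+ toℕ k) [mod p ]))
    → ((i j : Fin m) → i ≢ j → ∃[ l ] (l ∈ L × (+ ∣ A i ∩ A j ∣) ≡ (+ toℕ l) [mod p ]))
    → (i : ℕ) → i + 2 * ∣ K ∣ ≤ ∣ L ∣ + 1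
    → (I : Subset n) → I ⊆ X n → ∣ I ∣ ≡ i
    → InSpan p A (λ H → H ⊆ X n × i ≤ ∣ H ∣ × ∣ H ∣ < i + 2 * ∣ K ∣)
        (sumFormsWhere A (λ H → (H ⊆? X n) ×-dec ((∣ H ∣ ≟ i + 2 * ∣ K ∣) ×-dec (I ⊆? H))))
lemma2p2 p p-prime K L disjoint n m A sizes intersections .(∣ I ∣) bound I I⊆X refl with 2 * ∣ K ∣ <? p
... | yes 2|K|<p = smallCase p-prime K A sizes I I⊆X 2|K|<p
... | no  2|K|≮p
  with degenerate {p} {∣ K ∣} {∣ L ∣} {∣ I ∣} (nonTrivial⇒n>1 p {{prime⇒nonTrivial p-prime}})
                  (disjoint-size K L disjoint) bound (ℕ.≮⇒≥ 2|K|≮p)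
...   | refl , |K|≡1 , |I|≡0 = largeCase K L disjoint |K|≡1 A sizes intersections I |I|≡0
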